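{- Let $a$ be a positive integer and $b$ a prime number with $a<b$. Then for every integer $n\ge b+1$, $$\operatorname{lcm}(a,a+b,\dots,a+nb)\ \le\ \left(c_2\, b^{\frac{b}{b-1}}\right)^n,\qquad c_2:=12.30641.$$ -}

module Defs where

open import Data.Nat using (ℕ; suc; _+_; _*_)
open import Data.Nat.LCM using (lcm)
open import Data.List using (List; foldr; map; upTo)

lcmList : List ℕ → ℕ
lcmList = foldr lcm 1

lcmAP : ℕ → ℕ → ℕ → ℕ
lcmAP a b n = lcmList (map (λ i → a + i * b) (upTo (suc n)))

{-# OPTIONS --safe #-}
module Submission where

-- Write u j = a + j b and L m = lcm (u 0, …, u m), and let m ≤ k ≤ m + 1. Prime by prime,
-- u i · k! divides L m · b ^ ν_b(k!) · u (m+1) ⋯ u (m+k) for every i ≤ m + k. Indeed b ∤ u i,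
-- and for p ≠ b and q = p ^ t the multiples of q among 1, …, k are matched by at least as many
-- terms divisible by q among the k consecutive terms u (m+1), …, u (m+k), as b is invertible
-- mod q; if moreover q ∣ u i but q ∤ L m, then u i is one of these new terms while q > m + 1 ≥ k,
-- so there are no multiples of q to match. Hence L (m+k) · k! divides the same product, and
-- u j ≤ (j+1) b with (k+2)⋯(2k+1) ≤ 4 ^ k k! gives L (m+k) ≤ L m · 4 ^ k · b ^ (k + ν_b(k!)).
-- Halving n repeatedly and using (b − 1) ν_b(k!) ≤ k yields
-- L n ^ (b−1) ≤ b ^ (b−1) (4 ^ (b−1) b ^ b) ^ n, and b ^ (b−1) is absorbed into the constant
-- because b ≤ n < 2 ^ n and 2 · 4 ≤ 12.30641.

open import Defs
open import Data.Nat using (ℕ; suc; _+_; _*_; _∸_; _^_; _≤_; _<_)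
open import Data.Nat.Primality using (Prime)
open import Data.Nat
open import Data.Nat.Properties
open import Data.Nat.Divisibility
open import Data.Nat.Primality
open import Data.Nat.Primality.Factorisation using (factorise)
open import Data.Nat.Coprimality using (Coprime; coprime-Bézout; 1-coprimeTo) renaming (sym to coprime-sym)
open import Data.Nat.GCD using (gcd; module Bézout)
open import Data.Nat.LCM using (lcm; m∣lcm[m,n]; n∣lcm[m,n]; lcm-least; gcd*lcm)
open import Data.Nat.ListAction using (product)
open import Data.Nat.DivMod using (_%_; _/_; m≡m%n+[m/n]*n; m%n<n)
open import Data.Nat.Induction using (<-rec)
open import Data.Nat.Tactic.RingSolver using (solve-∀)
open import Data.List.Base using (_∷_; map; upTo)
open import Data.List.Membership.Propositional using (_∈_)
open import Data.List.Membership.Propositional.Properties using (∈-map⁺; ∈-upTo⁺)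
open import Data.List.Relation.Unary.All using (All; []; _∷_)
open import Data.List.Relation.Unary.All.Properties using (map⁺; applyUpTo⁺₁)
open import Data.List.Relation.Unary.Any using (here; there)
open import Data.Product.Base using (∃; _×_; _,_; proj₁)
open import Data.Sum.Base using (inj₁; inj₂; [_,_]′)
open import Function.Base using (id; _∘_)
open import Relation.Nullary.Decidable using (Dec; yes; no)
open import Relation.Nullary.Negation using (¬_; contradiction)
open import Relation.Unary using (Decidable)
open import Relation.Binary.PropositionalEquality
open import Algebra.Properties.CommutativeSemigroup +-commutativeSemigroup
  using () renaming (interchange to +-interchange)
open import Algebra.Properties.CommutativeSemigroup *-commutativeSemigroup
  using () renaming (interchange to *-interchange)

open ≤-Reasoning

-- Sums and products over ranges

InRange : ℕ → ℕ → ℕ → Set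
InRange s N x = s ≤ x × x < s + N

inRange-head : ∀ {s N} → InRange s (suc N) s
inRange-head {s} = ≤-refl , m<m+n s z<s

inRange-tail : ∀ {s N x} → InRange (suc s) N x → InRange s (suc N) x
inRange-tail {s} {N} {x} (s<x , x<1+s+N) = <⇒≤ s<x , subst (x <_) (sym (+-suc s N)) x<1+s+N

sumFrom : (ℕ → ℕ) → ℕ → ℕ → ℕ
sumFrom f s zero    = 0
sumFrom f s (suc N) = f s + sumFrom f (suc s) N

prodFrom : (ℕ → ℕ) → ℕ → ℕ → ℕ
prodFrom f s zero    = 1
prodFrom f s (suc N) = f s * prodFrom f (suc s) N

module _ {f g : ℕ → ℕ} where

  sumFrom-cong : ∀ s N → (∀ x → InRange s N x → f x ≡ g x) → sumFrom f s N ≡ sumFrom g s N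
  sumFrom-cong s zero    f≡g = refl
  sumFrom-cong s (suc N) f≡g =
    cong₂ _+_ (f≡g s inRange-head) (sumFrom-cong (suc s) N (λ x → f≡g x ∘ inRange-tail))

  sumFrom-mono : ∀ s N → (∀ x → InRange s N x → f x ≤ g x) → sumFrom f s N ≤ sumFrom g s N
  sumFrom-mono s zero    f≤g = z≤n
  sumFrom-mono s (suc N) f≤g =
    +-mono-≤ (f≤g s inRange-head) (sumFrom-mono (suc s) N (λ x → f≤g x ∘ inRange-tail))

  prodFrom-mono : ∀ s N → (∀ x → InRange s N x → f x ≤ g x) → prodFrom f s N ≤ prodFrom g s N
  prodFrom-mono s zero    f≤g = ≤-refl
  prodFrom-mono s (suc N) f≤g =
    *-mono-≤ (f≤g s inRange-head) (prodFrom-mono (suc s) N (λ x → f≤g x ∘ inRange-tail))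

  sumFrom-+ : ∀ s N → sumFrom (λ x → f x + g x) s N ≡ sumFrom f s N + sumFrom g s N
  sumFrom-+ s zero    = refl
  sumFrom-+ s (suc N) =
    trans (cong (f s + g s +_) (sumFrom-+ (suc s) N)) (+-interchange (f s) (g s) _ _)

sumFrom-zero : ∀ s N → sumFrom (λ _ → 0) s N ≡ 0
sumFrom-zero s zero    = refl
sumFrom-zero s (suc N) = sumFrom-zero (suc s) N

sumFrom-comm : ∀ (h : ℕ → ℕ → ℕ) s N s′ N′ →
  sumFrom (λ x → sumFrom (h x) s′ N′) s N ≡ sumFrom (λ y → sumFrom (λ x → h x y) s N) s′ N′
sumFrom-comm h s zero    s′ N′ = sym (sumFrom-zero s′ N′)
sumFrom-comm h s (suc N) s′ N′ =
  trans (cong (sumFrom (h s) s′ N′ +_) (sumFrom-comm h (suc s) N s′ N′)) (sym (sumFrom-+ s′ N′))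

sumFrom-++ : ∀ f s N M → sumFrom f s (N + M) ≡ sumFrom f s N + sumFrom f (s + N) M
sumFrom-++ f s zero    M = cong (λ s′ → sumFrom f s′ M) (sym (+-identityʳ s))
sumFrom-++ f s (suc N) M = begin-equality
  f s + sumFrom f (suc s) (N + M)                          ≡⟨ cong (f s +_) (sumFrom-++ f (suc s) N M) ⟩
  f s + (sumFrom f (suc s) N + sumFrom f (suc s + N) M)    ≡⟨ +-assoc (f s) _ _ ⟨
  sumFrom f s (suc N) + sumFrom f (suc s + N) M            ≡⟨ cong (λ s′ → sumFrom f s (suc N) + sumFrom f s′ M) (+-suc s N) ⟨
  sumFrom f s (suc N) + sumFrom f (s + suc N) M            ∎

sumFrom-snoc : ∀ f s N → sumFrom f s (suc N) ≡ sumFrom f s N + f (s + N)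
sumFrom-snoc f s N = begin-equality
  sumFrom f s (suc N)                         ≡⟨ cong (sumFrom f s) (+-comm 1 N) ⟩
  sumFrom f s (N + 1)                         ≡⟨ sumFrom-++ f s N 1 ⟩
  sumFrom f s N + (f (s + N) + 0)             ≡⟨ cong (sumFrom f s N +_) (+-identityʳ (f (s + N))) ⟩
  sumFrom f s N + f (s + N)                   ∎

sumFrom-≥-term : ∀ f s N {j} → InRange s N j → f j ≤ sumFrom f s N
sumFrom-≥-term f s zero    {j} (s≤j , j<s+0) = contradiction (subst (_≤ j) (sym (+-identityʳ s)) s≤j) (<⇒≱ j<s+0)
sumFrom-≥-term f s (suc N) {j} (s≤j , j<s+1+N) with s ≟ j
... | yes refl = m≤m+n (f s) _
... | no  s≢j  = ≤-trans (sumFrom-≥-term f (suc s) N (≤∧≢⇒< s≤j s≢j , subst (j <_) (+-suc s N) j<s+1+N))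
                         (m≤n+m _ (f s))

*-pos : ∀ {m n} → 0 < m → 0 < n → 0 < m * n
*-pos 0<m 0<n = *-mono-≤ 0<m 0<n

m*n>0⇒m>0 : ∀ m {n} → 0 < m * n → 0 < m
m*n>0⇒m>0 (suc m) _ = z<s

prodFrom-pos : ∀ f s N → (∀ x → InRange s N x → 0 < f x) → 0 < prodFrom f s N
prodFrom-pos f s zero    _   = z<s
prodFrom-pos f s (suc N) 0<f = *-pos (0<f s inRange-head) (prodFrom-pos f (suc s) N (λ x → 0<f x ∘ inRange-tail))

prodFrom-snoc : ∀ f s N → prodFrom f s (suc N) ≡ prodFrom f s N * f (s + N)
prodFrom-snoc f s zero    =
  trans (*-identityʳ (f s)) (trans (cong f (sym (+-identityʳ s))) (sym (*-identityˡ (f (s + 0)))))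
prodFrom-snoc f s (suc N) = begin-equality
  f s * prodFrom f (suc s) (suc N)                  ≡⟨ cong (f s *_) (prodFrom-snoc f (suc s) N) ⟩
  f s * (prodFrom f (suc s) N * f (suc s + N))      ≡⟨ *-assoc (f s) _ _ ⟨
  prodFrom f s (suc N) * f (suc s + N)              ≡⟨ cong (λ x → prodFrom f s (suc N) * f x) (+-suc s N) ⟨
  prodFrom f s (suc N) * f (s + suc N)              ∎

prodFrom-*ʳ : ∀ f c s N → prodFrom (λ x → f x * c) s N ≡ prodFrom f s N * c ^ N
prodFrom-*ʳ f c s zero    = refl
prodFrom-*ʳ f c s (suc N) =
  trans (cong (f s * c *_) (prodFrom-*ʳ f c (suc s) N)) (*-interchange (f s) c _ _)

!≡prodFrom : ∀ n → n ! ≡ prodFrom id 1 n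
!≡prodFrom zero    = refl
!≡prodFrom (suc n) = begin-equality
  suc n * n !              ≡⟨ *-comm (suc n) (n !) ⟩
  n ! * suc n              ≡⟨ cong (_* suc n) (!≡prodFrom n) ⟩
  prodFrom id 1 n * suc n  ≡⟨ prodFrom-snoc id 1 n ⟨
  prodFrom id 1 (suc n)    ∎

k!>0 : ∀ k → 0 < k !
k!>0 k = >-nonZero⁻¹ (k !) {{k !≢0}}

-- (k+2)⋯(2k+1) = C(2k+1, k) · k!, so this is C(2k+1, k) ≤ 4 ^ k.
central-product≤ : ∀ k → prodFrom suc (suc k) k ≤ 4 ^ k * k !
central-product≤ zero    = ≤-refl
central-product≤ (suc k) = *-cancelˡ-≤ (suc (suc k)) (begin
  prodFrom suc (suc k) (suc (suc k))                                ≡⟨ prodFrom-snoc suc (suc k) (suc k) ⟩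
  prodFrom suc (suc k) (suc k) * suc (suc k + suc k)                ≡⟨ cong (_* suc (suc k + suc k)) (prodFrom-snoc suc (suc k) k) ⟩
  prodFrom suc (suc k) k * suc (suc k + k) * suc (suc k + suc k)    ≤⟨ *-monoˡ-≤ _ (*-monoˡ-≤ _ (central-product≤ k)) ⟩
  4 ^ k * k ! * suc (suc k + k) * suc (suc k + suc k)               ≤⟨ *-monoʳ-≤ (4 ^ k * k ! * suc (suc k + k)) (n≤1+n _) ⟩
  4 ^ k * k ! * suc (suc k + k) * suc (suc (suc k + suc k))         ≡⟨ l (4 ^ k) (k !) k ⟩
  suc (suc k) * (4 ^ suc k * suc k !)                               ∎)
  where
  l : ∀ x y k → x * y * suc (suc k + k) * suc (suc (suc k + suc k)) ≡ suc (suc k) * (4 * x * (suc k * y))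
  l = solve-∀

prodFrom-suc≤4^k*k! : ∀ {s} k → s ≤ suc k → prodFrom suc s k ≤ 4 ^ k * k !
prodFrom-suc≤4^k*k! k s≤1+k = ≤-trans (monoˡ k s≤1+k) (central-product≤ k)
  where
  monoˡ : ∀ {s s′} k → s ≤ s′ → prodFrom suc s k ≤ prodFrom suc s′ k
  monoˡ zero    _    = ≤-refl
  monoˡ (suc k) s≤s′ = *-mono-≤ (s≤s s≤s′) (monoˡ k (s≤s s≤s′))

-- Counting multiples

indicator : ∀ {ℓ} {P : Set ℓ} → Dec P → ℕ
indicator (yes _) = 1
indicator (no  _) = 0

indicator-cong : ∀ {P Q : Set} (P? : Dec P) (Q? : Dec Q) → (P → Q) → (Q → P) → indicator P? ≡ indicator Q?
indicator-cong (yes _) (yes _)  _   _   = refl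
indicator-cong (yes p) (no ¬q)  P→Q _   = contradiction (P→Q p) ¬q
indicator-cong (no ¬p) (yes q)  _   Q→P = contradiction (Q→P q) ¬p
indicator-cong (no _)  (no _)   _   _   = refl

1≤∑indicator : ∀ {P : ℕ → Set} (P? : Decidable P) {s N j} → InRange s N j → P j →
  1 ≤ sumFrom (λ x → indicator (P? x)) s N
1≤∑indicator P? {s} {N} {j} j∈ Pj with P? j | sumFrom-≥-term (λ x → indicator (P? x)) s N j∈
... | yes _  | 1≤∑ = 1≤∑
... | no ¬Pj | _   = contradiction Pj ¬Pj

∑[t≤v]≡[v∸s]⊓T : ∀ v s T → sumFrom (λ t → indicator (t ≤? v)) (suc s) T ≡ (v ∸ s) ⊓ T
∑[t≤v]≡[v∸s]⊓T v s zero    = sym (⊓-zeroʳ (v ∸ s))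
∑[t≤v]≡[v∸s]⊓T v s (suc T) with suc s ≤? v
... | yes s<v = trans (cong suc (∑[t≤v]≡[v∸s]⊓T v (suc s) T)) (cong (_⊓ suc T) (sym (+-∸-assoc 1 s<v)))
... | no  s≮v = begin-equality
  sumFrom (λ t → indicator (t ≤? v)) (suc (suc s)) T ≡⟨ ∑[t≤v]≡[v∸s]⊓T v (suc s) T ⟩
  (v ∸ suc s) ⊓ T                                     ≡⟨ cong (_⊓ T) (m≤n⇒m∸n≡0 (m≤n⇒m≤1+n v≤s)) ⟩
  0                                                   ≡⟨ cong (_⊓ suc T) (m≤n⇒m∸n≡0 v≤s) ⟨
  (v ∸ s) ⊓ suc T                                     ∎
  where v≤s = s≤s⁻¹ (≰⇒> s≮v)

window-count : ∀ f q → (∀ s → 1 ≤ sumFrom f s q) → ∀ d s N → d * q ≤ N → d ≤ sumFrom f s N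
window-count f q window zero    s N _       = z≤n
window-count f q window (suc d) s N q+dq≤N = begin
  1 + d                                       ≤⟨ +-mono-≤ (window s) (window-count f q window d (s + q) (N ∸ q) dq≤N∸q) ⟩
  sumFrom f s q + sumFrom f (s + q) (N ∸ q)   ≡⟨ sumFrom-++ f s q (N ∸ q) ⟨
  sumFrom f s (q + (N ∸ q))                   ≡⟨ cong (sumFrom f s) (m+[n∸m]≡n q≤N) ⟩
  sumFrom f s N                               ∎
  where
  q≤N : q ≤ N
  q≤N = ≤-trans (m≤m+n q (d * q)) q+dq≤N
  dq≤N∸q : d * q ≤ N ∸ q
  dq≤N∸q = subst (_≤ N ∸ q) (m+n∸m≡n q (d * q)) (∸-monoˡ-≤ q q+dq≤N)

-- Bézout gives y with y b ≡ ∓ 1 (mod q); take k = c y, respectively k = c y (q − 1).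
∃[k]q∣c+k*b : ∀ {q b} → 0 < q → Coprime q b → ∀ c → ∃ λ k → q ∣ c + k * b
∃[k]q∣c+k*b {suc r} {b} _ q⊥b c with coprime-Bézout q⊥b
... | Bézout.+- x y 1+y*b≡x*q = c * y , divides (c * x) (begin-equality
  c + c * y * b      ≡⟨ l₁ c y b ⟩
  c * (1 + y * b)    ≡⟨ cong (c *_) 1+y*b≡x*q ⟩
  c * (x * suc r)    ≡⟨ *-assoc c x (suc r) ⟨
  c * x * suc r      ∎)
  where
  l₁ : ∀ c y b → c + c * y * b ≡ c * (1 + y * b)
  l₁ = solve-∀
... | Bézout.-+ x y 1+x*q≡y*b = c * y * r , divides (c + c * r * x) (begin-equality
  c + c * y * r * b            ≡⟨ l₁ c y r b ⟩
  c + c * r * (y * b)          ≡⟨ cong (λ z → c + c * r * z) 1+x*q≡y*b ⟨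
  c + c * r * (1 + x * suc r)  ≡⟨ l₂ c r x ⟩
  (c + c * r * x) * suc r      ∎)
  where
  l₁ : ∀ c y r b → c + c * y * r * b ≡ c + c * r * (y * b)
  l₁ = solve-∀
  l₂ : ∀ c r x → c + c * r * (1 + x * suc r) ≡ (c + c * r * x) * suc r
  l₂ = solve-∀

window-hit : ∀ {q b} → 0 < q → Coprime q b → ∀ a s → ∃ λ j → InRange s q j × q ∣ a + j * b
window-hit {suc r} {b} 0<q q⊥b a s with ∃[k]q∣c+k*b 0<q q⊥b (a + s * b)
... | k , q∣c+k*b = s + k % q , (m≤m+n s (k % q) , +-monoʳ-< s (m%n<n k q)) ,
                    ∣m+n∣m⇒∣n (subst (q ∣_) regroup q∣c+k*b) (n∣m*n (k / q * b))
  where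
  q = suc r
  l : ∀ a s b m d q → a + s * b + (m + d * q) * b ≡ d * b * q + (a + (s + m) * b)
  l = solve-∀
  regroup : a + s * b + k * b ≡ k / q * b * q + (a + (s + k % q) * b)
  regroup = trans (cong (λ k′ → a + s * b + k′ * b) (m≡m%n+[m/n]*n k q)) (l a s b (k % q) (k / q) q)

multiples : ℕ → ℕ → ℕ
multiples q N = sumFrom (λ x → indicator (q ∣? x)) 1 N

multiples*q≤N : ∀ q N → multiples q N * q ≤ N
multiples*q≤N q zero    = z≤n
multiples*q≤N q (suc N) = subst (λ c → c * q ≤ suc N) (sym (sumFrom-snoc _ 1 N)) (step (q ∣? suc N))
  where
  c = multiples q N
  step : (q∣?1+N : Dec (q ∣ suc N)) → (c + indicator q∣?1+N) * q ≤ suc N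
  step (no  _) = subst (λ c′ → c′ * q ≤ suc N) (sym (+-identityʳ c)) (m≤n⇒m≤1+n (multiples*q≤N q N))
  step (yes (divides d 1+N≡d*q)) =
    subst (λ c′ → c′ * q ≤ suc N) (+-comm 1 c) (subst (suc c * q ≤_) (sym 1+N≡d*q) (*-monoˡ-≤ q c<d))
    where
    c<d : c < d
    c<d = *-cancelʳ-< q c d (subst (c * q <_) 1+N≡d*q (s≤s (multiples*q≤N q N)))

≤multiples : ∀ {q d} → 0 < q → ∀ N → d * q ≤ N → d ≤ multiples q N
≤multiples {q} 0<q N = window-count _ q has-multiple _ 1 N
  where
  has-multiple : ∀ s → 1 ≤ sumFrom (λ x → indicator (q ∣? x)) s q
  has-multiple s with window-hit 0<q (coprime-sym (1-coprimeTo q)) 0 s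
  ... | j , j∈ , q∣j*1 = 1≤∑indicator (q ∣?_) j∈ (subst (q ∣_) (*-identityʳ j) q∣j*1)

multiples-< : ∀ {q N} → N < q → multiples q N ≡ 0
multiples-< {q} {N} N<q with multiples q N | multiples*q≤N q N
... | zero  | _      = refl
... | suc c | q+cq≤N = contradiction (≤-trans (m≤m+n q (c * q)) q+cq≤N) (<⇒≱ N<q)

-- p-adic valuation

prime>1 : ∀ {p} → Prime p → 1 < p
prime>1 {p} (prime _) = nonTrivial⇒n>1 p

prime∣p^t⇒≡ : ∀ {p q} t → Prime p → Prime q → q ∣ p ^ t → q ≡ p
prime∣p^t⇒≡ zero    _       q-prime q∣1 = contradiction (subst Prime (∣1⇒≡1 q∣1) q-prime) ¬prime[1]
prime∣p^t⇒≡ {p} (suc t) p-prime q-prime q∣p^[1+t] with euclidsLemma p (p ^ t) q-prime q∣p^[1+t]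
... | inj₂ q∣p^t = prime∣p^t⇒≡ t p-prime q-prime q∣p^t
... | inj₁ q∣p with prime⇒irreducible p-prime q∣p
...   | inj₁ q≡1 = contradiction (subst Prime q≡1 q-prime) ¬prime[1]
...   | inj₂ q≡p = q≡p

coprime-^ : ∀ {p q} t → Prime p → Prime q → p ≢ q → Coprime (p ^ t) q
coprime-^ t p-prime q-prime p≢q (i∣p^t , i∣q) with prime⇒irreducible q-prime i∣q
... | inj₁ i≡1 = i≡1
... | inj₂ refl = contradiction (sym (prime∣p^t⇒≡ t p-prime q-prime i∣p^t)) p≢q

^-monoʳ-∣ : ∀ p {m n} → m ≤ n → p ^ m ∣ p ^ n
^-monoʳ-∣ p {m} {n} m≤n =
  subst (p ^ m ∣_) (trans (sym (^-distribˡ-+-* p m (n ∸ m))) (cong (p ^_) (m+[n∸m]≡n m≤n))) (m∣m*n (p ^ (n ∸ m)))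

νWithin : ℕ → ℕ → ℕ → ℕ
νWithin zero    p x = 0
νWithin (suc f) p x with p ∣? x
... | yes (divides q _) = suc (νWithin f p q)
... | no  _             = 0

-- x divisions by p always suffice, since p ^ ν p x ≤ x.
ν : ℕ → ℕ → ℕ
ν p x = νWithin x p x

p^νWithin∣ : ∀ f p x → p ^ νWithin f p x ∣ x
p^νWithin∣ zero    p x = 1∣ x
p^νWithin∣ (suc f) p x with p ∣? x
... | yes (divides q x≡q*p) =
  subst (p ^ suc (νWithin f p q) ∣_) (sym x≡q*p) (subst (_∣ q * p) (*-comm _ p) (*-monoˡ-∣ p (p^νWithin∣ f p q)))
... | no  _ = 1∣ x

νWithin≤fuel : ∀ f p x → νWithin f p x ≤ f
νWithin≤fuel zero    p x = z≤n
νWithin≤fuel (suc f) p x with p ∣? x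
... | yes (divides q _) = s≤s (νWithin≤fuel f p q)
... | no  _             = z≤n

p^[1+νWithin]∤ : ∀ {p} → 1 < p → ∀ f {x} → 0 < x → x ≤ f → ¬ p ^ suc (νWithin f p x) ∣ x
p^[1+νWithin]∤ 1<p zero    0<x x≤0 = contradiction x≤0 (<⇒≱ 0<x)
p^[1+νWithin]∤ {p} 1<p (suc f) {x} 0<x x≤1+f with p ∣? x
... | no  p∤x = p∤x ∘ subst (_∣ x) (*-identityʳ p)
... | yes (divides q x≡q*p) =
  p^[1+νWithin]∤ 1<p f 0<q (s≤s⁻¹ (<-≤-trans q<x x≤1+f)) ∘ *-cancelʳ-∣ p ∘ subst₂ _∣_ (*-comm p _) x≡q*p
  where
  instance _ = >-nonZero (<-trans z<s 1<p)
  0<q : 0 < q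
  0<q = m*n>0⇒m>0 q (subst (0 <_) x≡q*p 0<x)
  q<x : q < x
  q<x = subst (q <_) (sym x≡q*p) (m<m*n q p {{>-nonZero 0<q}} 1<p)

p^ν∣ : ∀ p x → p ^ ν p x ∣ x
p^ν∣ p x = p^νWithin∣ x p x

p^[1+ν]∤ : ∀ {p x} → 1 < p → 0 < x → ¬ p ^ suc (ν p x) ∣ x
p^[1+ν]∤ 1<p 0<x = p^[1+νWithin]∤ 1<p _ 0<x ≤-refl

ν[x]≤x : ∀ p x → ν p x ≤ x
ν[x]≤x p x = νWithin≤fuel x p x

≤ν⇒^∣ : ∀ {p x t} → t ≤ ν p x → p ^ t ∣ x
≤ν⇒^∣ {p} {x} t≤ν = ∣-trans (^-monoʳ-∣ p t≤ν) (p^ν∣ p x)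

^∣⇒≤ν : ∀ {p x t} → 1 < p → 0 < x → p ^ t ∣ x → t ≤ ν p x
^∣⇒≤ν {p} 1<p 0<x p^t∣x = ≮⇒≥ λ ν<t → p^[1+ν]∤ 1<p 0<x (∣-trans (^-monoʳ-∣ p ν<t) p^t∣x)

∤⇒ν≡0 : ∀ {p x} → ¬ p ∣ x → ν p x ≡ 0
∤⇒ν≡0 {p} p∤x = n<1⇒n≡0 (≰⇒> λ 1≤ν → p∤x (subst (_∣ _) (*-identityʳ p) (≤ν⇒^∣ 1≤ν)))

ν-* : ∀ {p x y} → Prime p → 0 < x → 0 < y → ν p (x * y) ≡ ν p x + ν p y
ν-* {p} {x} {y} p-prime 0<x 0<y =
  ≤-antisym (≮⇒≥ too-large) (^∣⇒≤ν 1<p (*-pos 0<x 0<y) p^[νx+νy]∣xy)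
  where
  1<p = prime>1 p-prime
  νx = ν p x
  νy = ν p y
  p^[νx+νy]∣xy : p ^ (νx + νy) ∣ x * y
  p^[νx+νy]∣xy = subst (_∣ x * y) (sym (^-distribˡ-+-* p νx νy)) (*-pres-∣ (p^ν∣ p x) (p^ν∣ p y))
  too-large : ¬ νx + νy < ν p (x * y)
  too-large νx+νy<ν with p^ν∣ p x | p^ν∣ p y
  ... | divides x′ x≡x′*p^νx | divides y′ y≡y′*p^νy =
    [ p∤cofactor {v = νx} (p^[1+ν]∤ 1<p 0<x) x≡x′*p^νx
    , p∤cofactor {v = νy} (p^[1+ν]∤ 1<p 0<y) y≡y′*p^νy
    ]′ (euclidsLemma x′ y′ p-prime p∣x′y′)
    where
    instance _ = m^n≢0 p (νx + νy) {{>-nonZero (<-trans z<s 1<p)}}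
    p∤cofactor : ∀ {z z′ v} → ¬ p ^ suc v ∣ z → z ≡ z′ * p ^ v → ¬ p ∣ z′
    p∤cofactor {v = v} p^[1+v]∤z z≡z′*p^v p∣z′ = p^[1+v]∤z (subst (_ ∣_) (sym z≡z′*p^v) (*-monoˡ-∣ (p ^ v) p∣z′))
    xy≡ : x * y ≡ x′ * y′ * p ^ (νx + νy)
    xy≡ = begin-equality
      x * y                              ≡⟨ cong₂ _*_ x≡x′*p^νx y≡y′*p^νy ⟩
      x′ * p ^ νx * (y′ * p ^ νy)        ≡⟨ *-interchange x′ (p ^ νx) y′ (p ^ νy) ⟩
      x′ * y′ * (p ^ νx * p ^ νy)        ≡⟨ cong (x′ * y′ *_) (^-distribˡ-+-* p νx νy) ⟨
      x′ * y′ * p ^ (νx + νy)            ∎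
    p∣x′y′ : p ∣ x′ * y′
    p∣x′y′ = *-cancelʳ-∣ (p ^ (νx + νy)) (subst (p ^ suc (νx + νy) ∣_) xy≡ (≤ν⇒^∣ νx+νy<ν))

ν-prodFrom : ∀ {p} → Prime p → ∀ f s N → (∀ x → InRange s N x → 0 < f x) →
  ν p (prodFrom f s N) ≡ sumFrom (ν p ∘ f) s N
ν-prodFrom {p} p-prime f s zero    _   = ∤⇒ν≡0 λ p∣1 → <⇒≢ (prime>1 p-prime) (sym (∣1⇒≡1 p∣1))
ν-prodFrom {p} p-prime f s (suc N) 0<f = trans
  (ν-* p-prime (0<f s inRange-head) (prodFrom-pos f (suc s) N 0<f′))
  (cong (ν p (f s) +_) (ν-prodFrom p-prime f (suc s) N 0<f′))
  where
  0<f′ : ∀ x → InRange (suc s) N x → 0 < f x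
  0<f′ x = 0<f x ∘ inRange-tail

∑[p^t∣x]≡ν⊓T : ∀ {p x} → 1 < p → 0 < x → ∀ T → sumFrom (λ t → indicator (p ^ t ∣? x)) 1 T ≡ ν p x ⊓ T
∑[p^t∣x]≡ν⊓T {p} {x} 1<p 0<x T = trans
  (sumFrom-cong 1 T λ t _ → indicator-cong (p ^ t ∣? x) (t ≤? ν p x) (^∣⇒≤ν 1<p 0<x) ≤ν⇒^∣)
  (∑[t≤v]≡[v∸s]⊓T (ν p x) 0 T)

∑[p^t∣x]≤ν : ∀ {p x} → 1 < p → 0 < x → ∀ T → sumFrom (λ t → indicator (p ^ t ∣? x)) 1 T ≤ ν p x
∑[p^t∣x]≤ν {p} {x} 1<p 0<x T = ≤-trans (≤-reflexive (∑[p^t∣x]≡ν⊓T 1<p 0<x T)) (m⊓n≤m (ν p x) T)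

ν≡∑[p^t∣x] : ∀ {p x T} → 1 < p → 0 < x → ν p x ≤ T → ν p x ≡ sumFrom (λ t → indicator (p ^ t ∣? x)) 1 T
ν≡∑[p^t∣x] {T = T} 1<p 0<x ν≤T = sym (trans (∑[p^t∣x]≡ν⊓T 1<p 0<x T) (m≤n⇒m⊓n≡m ν≤T))

∑∑[p^t∣f]≤ν[∏f] : ∀ {p f} → Prime p → (∀ j → 0 < f j) → ∀ s N T →
  sumFrom (λ t → sumFrom (λ j → indicator (p ^ t ∣? f j)) s N) 1 T ≤ ν p (prodFrom f s N)
∑∑[p^t∣f]≤ν[∏f] {p} {f} p-prime 0<f s N T = begin
  sumFrom (λ t → sumFrom (λ j → indicator (p ^ t ∣? f j)) s N) 1 T
    ≡⟨ sumFrom-comm (λ j t → indicator (p ^ t ∣? f j)) s N 1 T ⟨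
  sumFrom (λ j → sumFrom (λ t → indicator (p ^ t ∣? f j)) 1 T) s N
    ≤⟨ sumFrom-mono s N (λ j _ → ∑[p^t∣x]≤ν (prime>1 p-prime) (0<f j) T) ⟩
  sumFrom (ν p ∘ f) s N
    ≡⟨ ν-prodFrom p-prime f s N (λ j _ → 0<f j) ⟨
  ν p (prodFrom f s N)
    ∎

product∣ : ∀ {ps} → All Prime ps → ∀ {n} → 0 < n → (∀ p → Prime p → ν p (product ps) ≤ ν p n) → product ps ∣ n
product∣ []                          {n} _   _   = 1∣ n
product∣ {p ∷ ps} (p-prime ∷ ps-prime) {n} 0<n ν≤ν =
  subst (p * product ps ∣_) (sym n≡p*n′) (*-monoʳ-∣ p (product∣ ps-prime 0<n′ ν≤ν′))
  where
  P = product ps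
  0<p = <-trans z<s (prime>1 p-prime)
  0<P = productOfPrimes≥1 ps-prime
  p∣n : p ∣ n
  p∣n = subst (_∣ n) (*-identityʳ p) (≤ν⇒^∣ (begin
    1                   ≤⟨ ^∣⇒≤ν (prime>1 p-prime) 0<p (∣-reflexive (*-identityʳ p)) ⟩
    ν p p               ≤⟨ m≤m+n (ν p p) (ν p P) ⟩
    ν p p + ν p P       ≡⟨ ν-* p-prime 0<p 0<P ⟨
    ν p (p * P)         ≤⟨ ν≤ν p p-prime ⟩
    ν p n               ∎))
  n′ = quotient p∣n
  n≡p*n′ : n ≡ p * n′
  n≡p*n′ = trans (_∣_.equality p∣n) (*-comm n′ p)
  0<n′ : 0 < n′
  0<n′ = m*n>0⇒m>0 n′ (subst (0 <_) (_∣_.equality p∣n) 0<n)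
  ν≤ν′ : ∀ r → Prime r → ν r P ≤ ν r n′
  ν≤ν′ r r-prime = +-cancelˡ-≤ (ν r p) _ _ (begin
    ν r p + ν r P       ≡⟨ ν-* r-prime 0<p 0<P ⟨
    ν r (p * P)         ≤⟨ ν≤ν r r-prime ⟩
    ν r n               ≡⟨ cong (ν r) n≡p*n′ ⟩
    ν r (p * n′)        ≡⟨ ν-* r-prime 0<p 0<n′ ⟩
    ν r p + ν r n′      ∎)

ν≤ν⇒∣ : ∀ {m n} → 0 < m → 0 < n → (∀ p → Prime p → ν p m ≤ ν p n) → m ∣ n
ν≤ν⇒∣ {m} {n} 0<m 0<n ν≤ν with factorise m {{>-nonZero 0<m}}
... | record { factors = ps ; isFactorisation = m≡∏ps ; factorsPrime = ps-prime } =
  subst (_∣ n) (sym m≡∏ps) (product∣ ps-prime 0<n λ p p-prime → subst (λ m′ → ν p m′ ≤ ν p n) m≡∏ps (ν≤ν p p-prime))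

-- Legendre's formula

ν[k!]≡∑multiples : ∀ {p} → Prime p → ∀ k T → k ≤ T → ν p (k !) ≡ sumFrom (λ t → multiples (p ^ t) k) 1 T
ν[k!]≡∑multiples {p} p-prime k T k≤T = begin-equality
  ν p (k !)                                                        ≡⟨ cong (ν p) (!≡prodFrom k) ⟩
  ν p (prodFrom id 1 k)                                            ≡⟨ ν-prodFrom p-prime id 1 k (λ _ → proj₁) ⟩
  sumFrom (ν p) 1 k                                                ≡⟨ sumFrom-cong 1 k ν≡∑ ⟩
  sumFrom (λ x → sumFrom (λ t → indicator (p ^ t ∣? x)) 1 T) 1 k   ≡⟨ sumFrom-comm (λ x t → indicator (p ^ t ∣? x)) 1 k 1 T ⟩
  sumFrom (λ t → multiples (p ^ t) k) 1 T                          ∎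
  where
  ν≡∑ : ∀ x → InRange 1 k x → ν p x ≡ sumFrom (λ t → indicator (p ^ t ∣? x)) 1 T
  ν≡∑ x (0<x , x<1+k) = ν≡∑[p^t∣x] (prime>1 p-prime) 0<x (≤-trans (ν[x]≤x p x) (≤-trans (s≤s⁻¹ x<1+k) k≤T))

geometric-tail : ∀ r (c : ℕ → ℕ) → (∀ t → suc r * c (suc t) ≤ c t) → ∀ s T → r * sumFrom c (suc s) T ≤ c s
geometric-tail r c shrink s zero    = subst (_≤ c s) (sym (*-zeroʳ r)) z≤n
geometric-tail r c shrink s (suc T) = begin
  r * (c (suc s) + sumFrom c (suc (suc s)) T)       ≡⟨ *-distribˡ-+ r (c (suc s)) _ ⟩
  r * c (suc s) + r * sumFrom c (suc (suc s)) T     ≤⟨ +-monoʳ-≤ (r * c (suc s)) (geometric-tail r c shrink (suc s) T) ⟩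
  r * c (suc s) + c (suc s)                         ≡⟨ +-comm (r * c (suc s)) (c (suc s)) ⟩
  suc r * c (suc s)                                 ≤⟨ shrink s ⟩
  c s                                               ∎

[p∸1]*ν[k!]≤k : ∀ {p} → Prime p → ∀ k → (p ∸ 1) * ν p (k !) ≤ k
[p∸1]*ν[k!]≤k {zero}  p-prime _ = contradiction p-prime ¬prime[0]
[p∸1]*ν[k!]≤k {suc r} p-prime k = begin
  r * ν (suc r) (k !)   ≡⟨ cong (r *_) (ν[k!]≡∑multiples p-prime k k ≤-refl) ⟩
  r * sumFrom c 1 k     ≤⟨ geometric-tail r c shrink 0 k ⟩
  c 0                   ≤⟨ subst (_≤ k) (*-identityʳ (c 0)) (multiples*q≤N 1 k) ⟩
  k                     ∎
  where
  c : ℕ → ℕ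
  c t = multiples (suc r ^ t) k
  shrink : ∀ t → suc r * c (suc t) ≤ c t
  shrink t = ≤multiples (m^n>0 (suc r) t) k (begin
    suc r * c (suc t) * suc r ^ t     ≡⟨ cong (_* suc r ^ t) (*-comm (suc r) (c (suc t))) ⟩
    c (suc t) * suc r * suc r ^ t     ≡⟨ *-assoc (c (suc t)) (suc r) (suc r ^ t) ⟩
    c (suc t) * suc r ^ suc t         ≤⟨ multiples*q≤N (suc r ^ suc t) k ⟩
    k                                 ∎)

lcm-pos : ∀ {m n} → 0 < m → 0 < n → 0 < lcm m n
lcm-pos {m} {n} 0<m 0<n = n≢0⇒n>0 λ lcm≡0 → <⇒≢ (*-pos 0<m 0<n) (sym (begin-equality
  m * n               ≡⟨ gcd*lcm m n ⟨
  gcd m n * lcm m n   ≡⟨ cong (gcd m n *_) lcm≡0 ⟩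
  gcd m n * 0         ≡⟨ *-zeroʳ (gcd m n) ⟩
  0                   ∎))

∈⇒∣lcmList : ∀ {x xs} → x ∈ xs → x ∣ lcmList xs
∈⇒∣lcmList {xs = y ∷ ys} (here refl)  = m∣lcm[m,n] y (lcmList ys)
∈⇒∣lcmList {xs = y ∷ ys} (there x∈ys) = ∣-trans (∈⇒∣lcmList x∈ys) (n∣lcm[m,n] y (lcmList ys))

lcmList-least : ∀ {xs n} → All (_∣ n) xs → lcmList xs ∣ n
lcmList-least {n = n} []  = 1∣ n
lcmList-least (x∣n ∷ xs∣n) = lcm-least x∣n (lcmList-least xs∣n)

lcmList-pos : ∀ {xs} → All (0 <_) xs → 0 < lcmList xs
lcmList-pos []           = z<s
lcmList-pos (0<x ∷ 0<xs) = lcm-pos 0<x (lcmList-pos 0<xs)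

all-terms : ∀ {P : ℕ → Set} a b n → (∀ {j} → j ≤ n → P (a + j * b)) → All P (map (λ j → a + j * b) (upTo (suc n)))
all-terms {P} a b n P-terms = map⁺ (applyUpTo⁺₁ {P = λ j → P (a + j * b)} id (suc n) (λ j<1+n → P-terms (s≤s⁻¹ j<1+n)))

term∣lcmAP : ∀ a b {n j} → j ≤ n → a + j * b ∣ lcmAP a b n
term∣lcmAP a b j≤n = ∈⇒∣lcmList (∈-map⁺ (λ j → a + j * b) (∈-upTo⁺ (s≤s j≤n)))

lcmAP-least : ∀ a b n {M} → (∀ {j} → j ≤ n → a + j * b ∣ M) → lcmAP a b n ∣ M
lcmAP-least a b n terms∣M = lcmList-least (all-terms a b n terms∣M)

lcmAP-pos : ∀ {a} b n → 0 < a → 0 < lcmAP a b n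
lcmAP-pos {a} b n 0<a = lcmList-pos (all-terms a b n λ {j} _ → <-≤-trans 0<a (m≤m+n a (j * b)))

lcmAP[0]≤a : ∀ {a} b → 0 < a → lcmAP a b 0 ≤ a
lcmAP[0]≤a {a} b 0<a = ∣⇒≤ {{>-nonZero 0<a}} (lcmAP-least a b 0 λ j≤0 →
  subst (λ j → a + j * b ∣ a) (sym (n≤0⇒n≡0 j≤0)) (∣-reflexive (+-identityʳ a)))

module ArithmeticProgression {a b : ℕ} (0<a : 0 < a) (a<b : a < b) (b-prime : Prime b) where

  private instance
    b≢0 : NonZero b
    b≢0 = prime⇒nonZero b-prime

  u : ℕ → ℕ
  u j = a + j * b

  0<u : ∀ j → 0 < u j
  0<u j = <-≤-trans 0<a (m≤m+n a (j * b))

  b∤u : ∀ j → ¬ b ∣ u j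
  b∤u j b∣u = <⇒≱ a<b (∣⇒≤ {{>-nonZero 0<a}} (∣m+n∣m⇒∣n (subst (b ∣_) (+-comm a (j * b)) b∣u) (n∣m*n j)))

  hits : ℕ → ℕ → ℕ → ℕ
  hits q s N = sumFrom (λ j → indicator (q ∣? u j)) s N

  multiples≤hits : ∀ {q} → 0 < q → Coprime q b → ∀ s N → multiples q N ≤ hits q s N
  multiples≤hits {q} 0<q q⊥b s N = window-count _ q has-hit (multiples q N) s N (multiples*q≤N q N)
    where
    has-hit : ∀ s → 1 ≤ hits q s q
    has-hit s with window-hit 0<q q⊥b a s
    ... | j , j∈ , q∣uⱼ = 1≤∑indicator (λ j → q ∣? u j) j∈ q∣uⱼ

  -- If q ∣ u i but q ∤ L m, then i > m and, as some u j with j < q is divisible by q,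
  -- also q > m + 1 ≥ k, so that multiples q k = 0.
  local-count : ∀ {q m k i} → 0 < q → Coprime q b → k ≤ suc m → i ≤ m + k →
    indicator (q ∣? u i) + multiples q k ≤ indicator (q ∣? lcmAP a b m) + hits q (suc m) k
  local-count {q} {m} {k} {i} 0<q q⊥b k≤1+m i≤m+k with q ∣? u i | q ∣? lcmAP a b m
  ... | no  _    | _       = ≤-trans (multiples≤hits 0<q q⊥b (suc m) k) (m≤n+m _ _)
  ... | yes _    | yes _   = s≤s (multiples≤hits 0<q q⊥b (suc m) k)
  ... | yes q∣uᵢ | no  q∤L = subst (λ c → suc c ≤ hits q (suc m) k) (sym (multiples-< k<q))
                               (1≤∑indicator (λ j → q ∣? u j) (m<i , s≤s i≤m+k) q∣uᵢ)
    where
    m<i : m < i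
    m<i = ≰⇒> λ i≤m → q∤L (∣-trans q∣uᵢ (term∣lcmAP a b i≤m))
    1+m<q : suc m < q
    1+m<q = ≰⇒> λ q≤1+m → let j , (_ , j<q) , q∣uⱼ = window-hit 0<q q⊥b a 0 in
      q∤L (∣-trans q∣uⱼ (term∣lcmAP a b (s≤s⁻¹ (≤-trans j<q q≤1+m))))
    k<q : k < q
    k<q = ≤-<-trans k≤1+m 1+m<q

  ν[u]+ν[k!]≤ν[lcmAP]+ν[∏u] : ∀ {p m k i} → Prime p → p ≢ b → k ≤ suc m → i ≤ m + k →
    ν p (u i) + ν p (k !) ≤ ν p (lcmAP a b m) + ν p (prodFrom u (suc m) k)
  ν[u]+ν[k!]≤ν[lcmAP]+ν[∏u] {p} {m} {k} {i} p-prime p≢b k≤1+m i≤m+k = begin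
    ν p (u i) + ν p (k !)
      ≡⟨ cong₂ _+_ (ν≡∑[p^t∣x] 1<p (0<u i) ν[uᵢ]≤T) (ν[k!]≡∑multiples p-prime k T (m≤m+n k (u i))) ⟩
    sumFrom (λ t → indicator (p ^ t ∣? u i)) 1 T + sumFrom (λ t → multiples (p ^ t) k) 1 T
      ≡⟨ sumFrom-+ 1 T ⟨
    sumFrom (λ t → indicator (p ^ t ∣? u i) + multiples (p ^ t) k) 1 T
      ≤⟨ sumFrom-mono 1 T (λ t _ → local-count (m^n>0 p t) (coprime-^ t p-prime b-prime p≢b) k≤1+m i≤m+k) ⟩
    sumFrom (λ t → indicator (p ^ t ∣? lcmAP a b m) + hits (p ^ t) (suc m) k) 1 T
      ≡⟨ sumFrom-+ 1 T ⟩
    sumFrom (λ t → indicator (p ^ t ∣? lcmAP a b m)) 1 T + sumFrom (λ t → hits (p ^ t) (suc m) k) 1 T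
      ≤⟨ +-mono-≤ (∑[p^t∣x]≤ν 1<p (lcmAP-pos b m 0<a) T) (∑∑[p^t∣f]≤ν[∏f] p-prime 0<u (suc m) k T) ⟩
    ν p (lcmAP a b m) + ν p (prodFrom u (suc m) k)
      ∎
    where
    instance _ = prime⇒nonZero p-prime
    1<p = prime>1 p-prime
    T = k + u i
    ν[uᵢ]≤T = ≤-trans (ν[x]≤x p (u i)) (m≤n+m (u i) k)

  commonMultiple : ℕ → ℕ → ℕ
  commonMultiple m k = lcmAP a b m * (b ^ ν b (k !) * prodFrom u (suc m) k)

  commonMultiple-pos : ∀ m k → 0 < commonMultiple m k
  commonMultiple-pos m k =
    *-pos (lcmAP-pos b m 0<a) (*-pos (m^n>0 b (ν b (k !))) (prodFrom-pos u (suc m) k (λ j _ → 0<u j)))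

  ν-commonMultiple : ∀ {p} m k → Prime p →
    ν p (commonMultiple m k) ≡ ν p (lcmAP a b m) + (ν p (b ^ ν b (k !)) + ν p (prodFrom u (suc m) k))
  ν-commonMultiple m k p-prime = trans
    (ν-* p-prime (lcmAP-pos b m 0<a) (*-pos 0<b^V 0<Q))
    (cong (_ +_) (ν-* p-prime 0<b^V 0<Q))
    where
    0<b^V = m^n>0 b (ν b (k !))
    0<Q = prodFrom-pos u (suc m) k (λ j _ → 0<u j)

  ν[u*k!]≤ν[commonMultiple] : ∀ {m k i} → k ≤ suc m → i ≤ m + k →
    ∀ p → Prime p → ν p (u i * k !) ≤ ν p (commonMultiple m k)
  ν[u*k!]≤ν[commonMultiple] {m} {k} {i} k≤1+m i≤m+k p p-prime with p ≟ b
  ... | yes refl = begin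
    ν b (u i * k !)                         ≡⟨ ν-* p-prime (0<u i) (k!>0 k) ⟩
    ν b (u i) + ν b (k !)                   ≡⟨ cong (_+ ν b (k !)) (∤⇒ν≡0 (b∤u i)) ⟩
    ν b (k !)                               ≤⟨ ^∣⇒≤ν (prime>1 p-prime) (m^n>0 b (ν b (k !))) ∣-refl ⟩
    ν b (b ^ ν b (k !))                     ≤⟨ m≤m+n _ _ ⟩
    ν b (b ^ ν b (k !)) + ν b Q             ≤⟨ m≤n+m _ (ν b L) ⟩
    ν b L + (ν b (b ^ ν b (k !)) + ν b Q)   ≡⟨ ν-commonMultiple m k p-prime ⟨
    ν b (commonMultiple m k)                ∎
    where
    L = lcmAP a b m
    Q = prodFrom u (suc m) k
  ... | no p≢b = begin
    ν p (u i * k !)                         ≡⟨ ν-* p-prime (0<u i) (k!>0 k) ⟩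
    ν p (u i) + ν p (k !)                   ≤⟨ ν[u]+ν[k!]≤ν[lcmAP]+ν[∏u] p-prime p≢b k≤1+m i≤m+k ⟩
    ν p L + ν p Q                           ≤⟨ +-monoʳ-≤ (ν p L) (m≤n+m (ν p Q) (ν p (b ^ ν b (k !)))) ⟩
    ν p L + (ν p (b ^ ν b (k !)) + ν p Q)   ≡⟨ ν-commonMultiple m k p-prime ⟨
    ν p (commonMultiple m k)                ∎
    where
    L = lcmAP a b m
    Q = prodFrom u (suc m) k

  u*k!∣commonMultiple : ∀ {m k i} → k ≤ suc m → i ≤ m + k → u i * k ! ∣ commonMultiple m k
  u*k!∣commonMultiple {m} {k} {i} k≤1+m i≤m+k =
    ν≤ν⇒∣ (*-pos (0<u i) (k!>0 k)) (commonMultiple-pos m k) (ν[u*k!]≤ν[commonMultiple] k≤1+m i≤m+k)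

  lcmAP*k!∣commonMultiple : ∀ {m k} → k ≤ suc m → lcmAP a b (m + k) * k ! ∣ commonMultiple m k
  lcmAP*k!∣commonMultiple {m} {k} k≤1+m with m*n∣⇒n∣ (u 0) (k !) (u*k!∣commonMultiple k≤1+m z≤n)
  ... | divides c M≡c*k! =
    subst (lcmAP a b (m + k) * k ! ∣_) (sym M≡c*k!) (*-monoˡ-∣ (k !) (lcmAP-least a b (m + k) u∣c))
    where
    u∣c : ∀ {j} → j ≤ m + k → u j ∣ c
    u∣c {j} j≤m+k = *-cancelʳ-∣ (k !) {{k !≢0}} (subst (u j * k ! ∣_) M≡c*k! (u*k!∣commonMultiple k≤1+m j≤m+k))

  prodFrom-u≤ : ∀ {m k} → m ≤ k → prodFrom u (suc m) k ≤ 4 ^ k * k ! * b ^ k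
  prodFrom-u≤ {m} {k} m≤k = begin
    prodFrom u (suc m) k                   ≤⟨ prodFrom-mono (suc m) k (λ j _ → +-monoˡ-≤ (j * b) (<⇒≤ a<b)) ⟩
    prodFrom (λ j → suc j * b) (suc m) k   ≡⟨ prodFrom-*ʳ suc b (suc m) k ⟩
    prodFrom suc (suc m) k * b ^ k         ≤⟨ *-monoˡ-≤ (b ^ k) (prodFrom-suc≤4^k*k! k (s≤s m≤k)) ⟩
    4 ^ k * k ! * b ^ k                    ∎

  lcmAP-step : ∀ {m k} → m ≤ k → k ≤ suc m → lcmAP a b (m + k) ≤ lcmAP a b m * (4 ^ k * b ^ (ν b (k !) + k))
  lcmAP-step {m} {k} m≤k k≤1+m = *-cancelʳ-≤ _ _ (k !) {{k !≢0}} (begin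
    lcmAP a b (m + k) * k !               ≤⟨ ∣⇒≤ {{>-nonZero (commonMultiple-pos m k)}} (lcmAP*k!∣commonMultiple k≤1+m) ⟩
    L * (b ^ V * prodFrom u (suc m) k)    ≤⟨ *-monoʳ-≤ L (*-monoʳ-≤ (b ^ V) (prodFrom-u≤ m≤k)) ⟩
    L * (b ^ V * (4 ^ k * k ! * b ^ k))   ≡⟨ l L (b ^ V) (4 ^ k) (k !) (b ^ k) ⟩
    L * (4 ^ k * (b ^ V * b ^ k)) * k !   ≡⟨ cong (λ z → L * (4 ^ k * z) * k !) (^-distribˡ-+-* b V k) ⟨
    L * (4 ^ k * b ^ (V + k)) * k !       ∎)
    where
    L = lcmAP a b m
    V = ν b (k !)
    l : ∀ L X F f B → L * (X * (F * f * B)) ≡ L * (F * (X * B)) * f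
    l = solve-∀

^-distrib-* : ∀ m n o → (m * n) ^ o ≡ m ^ o * n ^ o
^-distrib-* m n zero    = refl
^-distrib-* m n (suc o) = trans (cong (m * n *_) (^-distrib-* m n o)) (*-interchange m n (m ^ o) (n ^ o))

step-factor^r≤ : ∀ r {V k} → r * V ≤ k → (4 ^ k * suc r ^ (V + k)) ^ r ≤ (4 ^ r * suc r ^ suc r) ^ k
step-factor^r≤ r {V} {k} rV≤k = begin
  (4 ^ k * b ^ (V + k)) ^ r           ≡⟨ ^-distrib-* (4 ^ k) (b ^ (V + k)) r ⟩
  (4 ^ k) ^ r * (b ^ (V + k)) ^ r     ≡⟨ cong₂ _*_ (^-*-assoc 4 k r) (^-*-assoc b (V + k) r) ⟩
  4 ^ (k * r) * b ^ ((V + k) * r)     ≤⟨ *-monoʳ-≤ (4 ^ (k * r)) (^-monoʳ-≤ b exponent≤) ⟩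
  4 ^ (k * r) * b ^ (b * k)           ≡⟨ cong₂ _*_ (trans (cong (4 ^_) (*-comm k r)) (sym (^-*-assoc 4 r k)))
                                                    (sym (^-*-assoc b b k)) ⟩
  (4 ^ r) ^ k * (b ^ b) ^ k           ≡⟨ ^-distrib-* (4 ^ r) (b ^ b) k ⟨
  (4 ^ r * b ^ b) ^ k                 ∎
  where
  b = suc r
  exponent≤ : (V + k) * r ≤ b * k
  exponent≤ = begin
    (V + k) * r      ≡⟨ *-distribʳ-+ r V k ⟩
    V * r + k * r    ≤⟨ +-monoˡ-≤ (k * r) (subst (_≤ k) (*-comm r V) rV≤k) ⟩
    k + k * r        ≡⟨ cong (k +_) (*-comm k r) ⟩
    b * k            ∎

lcmAP-bound : ∀ {a b} → 0 < a → a < b → Prime b → ∀ n →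
  lcmAP a b n ^ (b ∸ 1) ≤ b ^ (b ∸ 1) * (4 ^ (b ∸ 1) * b ^ b) ^ n
lcmAP-bound {b = zero}      _   _   b-prime _ = contradiction b-prime ¬prime[0]
lcmAP-bound {a} {b@(suc r)} 0<a a<b b-prime   = <-rec _ bound
  where
  open ArithmeticProgression 0<a a<b b-prime using (lcmAP-step)
  growth = 4 ^ r * b ^ b
  bound : ∀ n → (∀ {m} → m < n → lcmAP a b m ^ r ≤ b ^ r * growth ^ m) → lcmAP a b n ^ r ≤ b ^ r * growth ^ n
  bound zero    _  = subst (lcmAP a b 0 ^ r ≤_) (sym (*-identityʳ (b ^ r)))
                       (^-monoˡ-≤ r (≤-trans (lcmAP[0]≤a b 0<a) (<⇒≤ a<b)))
  bound (suc n) IH = begin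
    lcmAP a b (suc n) ^ r                  ≡⟨ cong (λ N → lcmAP a b N ^ r) m+k≡1+n ⟨
    lcmAP a b (m + k) ^ r                  ≤⟨ ^-monoˡ-≤ r (lcmAP-step (⌊n/2⌋≤⌈n/2⌉ (suc n)) (⌈n/2⌉-mono (n≤1+n (suc n)))) ⟩
    (lcmAP a b m * X) ^ r                  ≡⟨ ^-distrib-* (lcmAP a b m) X r ⟩
    lcmAP a b m ^ r * X ^ r                ≤⟨ *-mono-≤ (IH (⌊n/2⌋<n n)) (step-factor^r≤ r ([p∸1]*ν[k!]≤k b-prime k)) ⟩
    b ^ r * growth ^ m * growth ^ k        ≡⟨ *-assoc (b ^ r) (growth ^ m) (growth ^ k) ⟩
    b ^ r * (growth ^ m * growth ^ k)      ≡⟨ cong (b ^ r *_) (^-distribˡ-+-* growth m k) ⟨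
    b ^ r * growth ^ (m + k)               ≡⟨ cong (λ N → b ^ r * growth ^ N) m+k≡1+n ⟩
    b ^ r * growth ^ suc n                 ∎
    where
    m = ⌊ suc n /2⌋
    k = ⌈ suc n /2⌉
    m+k≡1+n = ⌊n/2⌋+⌈n/2⌉≡n (suc n)
    X = 4 ^ k * b ^ (ν b (k !) + k)

n<2^n : ∀ n → n < 2 ^ n
n<2^n zero    = z<s
n<2^n (suc n) = +-mono-≤ (m^n>0 2 n) (≤-trans (n<2^n n) (m≤m+n (2 ^ n) 0))

b*400000^n≤1230641^n : ∀ {b n} → b ≤ n → b * 400000 ^ n ≤ 1230641 ^ n
b*400000^n≤1230641^n {b} {n} b≤n = begin
  b * 400000 ^ n        ≤⟨ *-monoˡ-≤ (400000 ^ n) (≤-trans b≤n (<⇒≤ (n<2^n n))) ⟩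
  2 ^ n * 400000 ^ n    ≡⟨ ^-distrib-* 2 400000 n ⟨
  800000 ^ n            ≤⟨ ^-monoˡ-≤ n (≤ᵇ⇒≤ 800000 1230641 _) ⟩
  1230641 ^ n           ∎

bound-regroup : ∀ r n → let b = suc r in
  b ^ r * (4 ^ r * b ^ b) ^ n * 100000 ^ (n * r) ≡ b ^ (b * n) * (b * 400000 ^ n) ^ r
bound-regroup r n = begin-equality
  b ^ r * (4 ^ r * b ^ b) ^ n * H                ≡⟨ cong (λ z → b ^ r * z * H) (^-distrib-* (4 ^ r) (b ^ b) n) ⟩
  b ^ r * ((4 ^ r) ^ n * (b ^ b) ^ n) * H        ≡⟨ cong₂ (λ x y → b ^ r * (x * y) * H)
                                                      (trans (^-*-assoc 4 r n) (cong (4 ^_) (*-comm r n))) (^-*-assoc b b n) ⟩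
  b ^ r * (4 ^ (n * r) * b ^ (b * n)) * H        ≡⟨ l (b ^ r) (4 ^ (n * r)) (b ^ (b * n)) H ⟩
  b ^ (b * n) * (b ^ r * (4 ^ (n * r) * H))      ≡⟨ cong (λ z → b ^ (b * n) * (b ^ r * z)) (^-distrib-* 4 100000 (n * r)) ⟨
  b ^ (b * n) * (b ^ r * 400000 ^ (n * r))       ≡⟨ cong (λ z → b ^ (b * n) * (b ^ r * z)) (^-*-assoc 400000 n r) ⟨
  b ^ (b * n) * (b ^ r * (400000 ^ n) ^ r)       ≡⟨ cong (b ^ (b * n) *_) (^-distrib-* b (400000 ^ n) r) ⟨
  b ^ (b * n) * (b * 400000 ^ n) ^ r             ∎
  where
  b = suc r
  H = 100000 ^ (n * r)
  l : ∀ x y z w → x * (y * z) * w ≡ z * (x * (y * w))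
  l = solve-∀

mainTheorem7 : (a b : ℕ) → 0 < a → Prime b → a < b → (n : ℕ) → b + 1 ≤ n →
    lcmAP a b n ^ (b ∸ 1) * 100000 ^ (n * (b ∸ 1)) ≤ 1230641 ^ (n * (b ∸ 1)) * b ^ (b * n)
mainTheorem7 a zero          _   b-prime = contradiction b-prime ¬prime[0]
mainTheorem7 a b@(suc r) 0<a b-prime a<b n b+1≤n = begin
  lcmAP a b n ^ r * 100000 ^ (n * r)                   ≤⟨ *-monoˡ-≤ (100000 ^ (n * r)) (lcmAP-bound 0<a a<b b-prime n) ⟩
  b ^ r * (4 ^ r * b ^ b) ^ n * 100000 ^ (n * r)       ≡⟨ bound-regroup r n ⟩
  b ^ (b * n) * (b * 400000 ^ n) ^ r                   ≤⟨ *-monoʳ-≤ (b ^ (b * n)) (^-monoˡ-≤ r (b*400000^n≤1230641^n b≤n)) ⟩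
  b ^ (b * n) * (1230641 ^ n) ^ r                      ≡⟨ cong (b ^ (b * n) *_) (^-*-assoc 1230641 n r) ⟩
  b ^ (b * n) * 1230641 ^ (n * r)                      ≡⟨ *-comm (b ^ (b * n)) (1230641 ^ (n * r)) ⟩
  1230641 ^ (n * r) * b ^ (b * n)                      ∎
  where
  b≤n = ≤-trans (m≤m+n b 1) b+1≤n
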